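{- Let $n\ge 2$, let $\mathcal{C}_1 = \mathcal{C}(I^1_1,g^1),\ldots,\mathcal{C}_n=\mathcal{C}(I^n_1,g^n)$ be hole-decreasing Cantor sets and $x_1,\ldots,x_n \ge 0$ real numbers with $\mathrm{dr}_{\mathcal{C}_j} \ge x_j$ for all $j$, $\sum_{j=1}^n \frac{x_j}{x_j+1} \ge 1$, and $|I^j_1| \ge \frac{x_j}{x_j+1}(x_k+1)|I^k_1|$ for all $j,k$. Let $I^1_{i_1}, \ldots, I^n_{i_n}$ be comparable intervals (with respect to these data). Then for every $k \in \{1,\ldots,n\}$, $$\sum_{j=1}^n I^j_{i_j} = \Big(\sum_{j \ne k} I^j_{i_j} + I^k_{2i_k}\Big) \cup \Big(\sum_{j \ne k} I^j_{i_j} + I^k_{2i_k+1}\Big).$$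
   Context: For an interval $I$ with endpoints $a<b$ write $|I| = b-a$. A Cantor set $\mathcal{C}(I_1, g)$ is given by a closed interval $I_1$ of positive length and a gap function $g$: recursively, for every constructed interval $I_i$, $g(I_i)$ is an open subinterval of $I_i$ with $I_i = I_{2i} \cup g(I_i) \cup I_{2i+1}$ disjointly, $I_{2i}, I_{2i+1}$ closed intervals of positive length left and right of the gap; the set is $I_1 \setminus \bigcup_i g(I_i)$. The density ratio is $\mathrm{dr} = \inf_i \min(|I_{2i}|,|I_{2i+1}|)/|g(I_i)|$. It is hole-decreasing if $|g(I_{2i})| \le |g(I_i)|$ and $|g(I_{2i+1})| \le |g(I_i)|$ for all $i$. Here $I^j_m$ denotes the intervals in the construction of $\mathcal{C}_j$. Intervals $I^1_{i_1},\ldots,I^n_{i_n}$ (with $I^j_{i_j}$ an interval of the construction of $\mathcal{C}_j$) are called comparable if for all $j,k$: $|I^j_{i_j}| \ge \frac{x_j}{x_j+1}(x_k+1)\,|g^k(I^k_{i_k})|$. Sums of sets are pointwise. -}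

module Defs where

open import Data.Nat using (ℕ; zero; suc) renaming (_*_ to _*ℕ_; _≤_ to _≤ℕ_)
open import Data.Fin using (Fin; _≟_) renaming (zero to fzero; suc to fsuc)
open import Data.Product using (Σ; ∃; _×_; _,_)
open import Data.Sum using (_⊎_)
open import Relation.Binary.PropositionalEquality using (_≡_)
open import Relation.Nullary using (¬_; yes; no)

-- The real numbers, axiomatised as a complete ordered field.
-- (agda-stdlib has no real numbers; every model of this record is
-- classically isomorphic to ℝ, and the theorem quantifies over all models.)
-- Division uses the total-inverse convention 0⁻¹ = 0; it is only ever
-- applied to nonzero quantities in the statement.

record Reals : Set₁ where
  infixl 6 _+_
  infixl 7 _*_
  infix 4 _≤_
  field
    Carrier : Set
    _+_ _*_ : Carrier → Carrier → Carrier
    -_ : Carrier → Carrier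
    _⁻¹ : Carrier → Carrier
    0# 1# : Carrier
    _≤_ : Carrier → Carrier → Set
    +-assoc : ∀ x y z → (x + y) + z ≡ x + (y + z)
    +-comm : ∀ x y → x + y ≡ y + x
    +-identityˡ : ∀ x → 0# + x ≡ x
    +-inverseˡ : ∀ x → (- x) + x ≡ 0#
    *-assoc : ∀ x y z → (x * y) * z ≡ x * (y * z)
    *-comm : ∀ x y → x * y ≡ y * x
    *-identityˡ : ∀ x → 1# * x ≡ x
    distribˡ : ∀ x y z → x * (y + z) ≡ (x * y) + (x * z)
    0≢1 : ¬ (0# ≡ 1#)
    *-inverseʳ : ∀ x → ¬ (x ≡ 0#) → x * (x ⁻¹) ≡ 1#
    0⁻¹ : 0# ⁻¹ ≡ 0#
    ≤-refl : ∀ x → x ≤ x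
    ≤-trans : ∀ {x y z} → x ≤ y → y ≤ z → x ≤ z
    ≤-antisym : ∀ {x y} → x ≤ y → y ≤ x → x ≡ y
    ≤-total : ∀ x y → x ≤ y ⊎ y ≤ x
    +-monoˡ-≤ : ∀ {x y} z → x ≤ y → x + z ≤ y + z
    *-nonneg : ∀ {x y} → 0# ≤ x → 0# ≤ y → 0# ≤ x * y
    lub : (P : Carrier → Set) → Σ Carrier P →
          Σ Carrier (λ b → ∀ y → P y → y ≤ b) →
          Σ Carrier (λ s → (∀ y → P y → y ≤ s) ×
                           (∀ b → (∀ y → P y → y ≤ b) → s ≤ b))

module _ (R : Reals) where
  open Reals R

  infix 4 _<_
  _<_ : Carrier → Carrier → Set
  x < y = x ≤ y × ¬ (x ≡ y)

  _-_ : Carrier → Carrier → Carrier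
  x - y = x + (- y)

  _/_ : Carrier → Carrier → Carrier
  x / y = x * (y ⁻¹)

  frac : Carrier → Carrier
  frac x = x / (x + 1#)

  sumF : ∀ {n} → (Fin n → Carrier) → Carrier
  sumF {zero} f = 0#
  sumF {suc n} f = f fzero + sumF (λ j → f (fsuc j))

  -- A Cantor set C(I_1, g), given through its construction intervals.
  -- Index i ≥ 1: I_i = [lft i, rgt i], gap g(I_i) = (gl i, gr i),
  -- I_{2i} = [lft i, gl i], I_{2i+1} = [gr i, rgt i].
  record Cantor : Set where
    field
      lft rgt gl gr : ℕ → Carrier
      gap-inside : ∀ i → 1 ≤ℕ i → (lft i < gl i) × (gl i < gr i) × (gr i < rgt i)
      left-child : ∀ i → 1 ≤ℕ i → (lft (2 *ℕ i) ≡ lft i) × (rgt (2 *ℕ i) ≡ gl i)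
      right-child : ∀ i → 1 ≤ℕ i → (lft (suc (2 *ℕ i)) ≡ gr i) × (rgt (suc (2 *ℕ i)) ≡ rgt i)

  open Cantor

  len : Cantor → ℕ → Carrier
  len C i = rgt C i - lft C i

  gapLen : Cantor → ℕ → Carrier
  gapLen C i = gr C i - gl C i

  Iv : Cantor → ℕ → Carrier → Set
  Iv C i y = (lft C i ≤ y) × (y ≤ rgt C i)

  -- dr_C ≥ x, i.e. x is a lower bound of
  -- { min(|I_{2i}|,|I_{2i+1}|) / |g(I_i)| : i ≥ 1 }
  DrAtLeast : Cantor → Carrier → Set
  DrAtLeast C x = ∀ i → 1 ≤ℕ i →
    (x ≤ len C (2 *ℕ i) / gapLen C i) × (x ≤ len C (suc (2 *ℕ i)) / gapLen C i)

  HoleDecreasing : Cantor → Set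
  HoleDecreasing C = ∀ i → 1 ≤ℕ i →
    (gapLen C (2 *ℕ i) ≤ gapLen C i) × (gapLen C (suc (2 *ℕ i)) ≤ gapLen C i)

  Comparable : ∀ {n} → (Fin n → Cantor) → (Fin n → Carrier) → (Fin n → ℕ) → Set
  Comparable C x i = ∀ j k →
    frac (x j) * (x k + 1#) * gapLen (C k) (i k) ≤ len (C j) (i j)

  MinkSum : ∀ {n} → (Fin n → Carrier → Set) → Carrier → Set
  MinkSum S y = Σ (Fin _ → Carrier) (λ p → (∀ j → S j (p j)) × (y ≡ sumF p))

  Union : (Carrier → Set) → (Carrier → Set) → Carrier → Set
  Union A B y = A y ⊎ B y

  SetEq : (Carrier → Set) → (Carrier → Set) → Set
  SetEq A B = ∀ y → (A y → B y) × (B y → A y)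

replaceAt : ∀ {a} {A : Set a} {n} → Fin n → A → (Fin n → A) → Fin n → A
replaceAt k v f j with j ≟ k
... | yes _ = v
... | no _ = f j

{-# OPTIONS --safe #-}
module Submission where

-- A Minkowski sum of closed intervals [lo j, hi j] is the interval [Σ lo, Σ hi]. Replacing
-- I^k = [a, b] by its children [a, l] and [r, b], where (l, r) is the gap, therefore yields
-- the intervals [Σ lo, l + Σ_{j≠k} hi] and [r + Σ_{j≠k} lo, Σ hi], whose union is all of
-- [Σ lo, Σ hi] as soon as they overlap, i.e. as soon as r - l ≤ Σ_{j≠k} |I^j|.
-- Comparability gives |I^j| ≥ x_j/(x_j+1)·(x_k+1)·|g^k| for every j. Summed over all j
-- these bounds total at least (x_k+1)|g^k|, because Σ x_j/(x_j+1) ≥ 1, and the k-th one is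
-- x_k|g^k|, so the terms with j ≠ k leave at least |g^k|.

open import Defs hiding (_-_)
open import Algebra.Bundles using (CommutativeRing)
open import Algebra.Structures using (IsCommutativeRing)
open import Algebra.Consequences.Propositional
  using (comm∧idˡ⇒idʳ; comm∧invˡ⇒invʳ; comm∧distrˡ⇒distrʳ)
import Algebra.Properties.Ring as RingProperties
import Algebra.Properties.CommutativeSemigroup as CommutativeSemigroupProperties
open import Data.Empty using (⊥-elim)
open import Data.Fin using (Fin; _≟_; punchIn) renaming (zero to fzero; suc to fsuc)
open import Data.Fin.Properties using (punchInᵢ≢i)
open import Data.Nat using (ℕ; zero; suc) renaming (_*_ to _*ℕ_; _≤_ to _≤ℕ_)
open import Data.Product using (_×_; _,_; proj₁; proj₂)
open import Data.Sum using (inj₁; inj₂; [_,_]; [_,_]′)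
open import Data.Vec.Functional using (_∷_; tail)
open import Relation.Binary.Bundles using (Poset)
open import Relation.Binary.Structures using (IsPartialOrder)
import Relation.Binary.Reasoning.PartialOrder as PosetReasoning
open import Relation.Binary.PropositionalEquality
  using (_≡_; _≢_; refl; sym; trans; cong; cong₂; subst; isEquivalence; module ≡-Reasoning)
open import Relation.Nullary using (yes; no)
open import Relation.Unary using (Pred; _⊆_; _≐_)

module _ {a} {A : Set a} {n : ℕ} where

  replaceAt-here : ∀ k (v : A) f → replaceAt {n = n} k v f k ≡ v
  replaceAt-here k v f with k ≟ k
  ... | yes _ = refl
  ... | no k≢k = ⊥-elim (k≢k refl)

  replaceAt-there : ∀ {k j} (v : A) f → j ≢ k → replaceAt {n = n} k v f j ≡ f j
  replaceAt-there {k} {j} v f j≢k with j ≟ k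
  ... | yes j≡k = ⊥-elim (j≢k j≡k)
  ... | no _ = refl

  replaceAt-all : ∀ {p} (P : Fin n → A → Set p) {k v f} →
    P k v → (∀ j → P j (f j)) → ∀ j → P j (replaceAt k v f j)
  replaceAt-all P {k} pv pf j with j ≟ k
  ... | yes refl = pv
  ... | no _ = pf j

  replaceAt-pointwise : ∀ {b p} {B : Set b} (P : Fin n → A → B → Set p) {k v f w g} →
    P k v w → (∀ j → P j (f j) (g j)) → ∀ j → P j (replaceAt k v f j) (replaceAt k w g j)
  replaceAt-pointwise P {k} pvw pfg j with j ≟ k
  ... | yes refl = pvw
  ... | no _ = pfg j

module _ (R : Reals) where
  open Reals R

  infixl 6 _-_
  _-_ : Carrier → Carrier → Carrier
  _-_ = Defs._-_ R

  +-*-isCommutativeRing : IsCommutativeRing _≡_ _+_ _*_ -_ 0# 1#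
  +-*-isCommutativeRing = record
    { isRing = record
      { +-isAbelianGroup = record
        { isGroup = record
          { isMonoid = record
            { isSemigroup = record
              { isMagma = record { isEquivalence = isEquivalence ; ∙-cong = cong₂ _+_ }
              ; assoc = +-assoc }
            ; identity = +-identityˡ , comm∧idˡ⇒idʳ +-comm +-identityˡ }
          ; inverse = +-inverseˡ , comm∧invˡ⇒invʳ +-comm +-inverseˡ
          ; ⁻¹-cong = cong (-_) }
        ; comm = +-comm }
      ; *-cong = cong₂ _*_
      ; *-assoc = *-assoc
      ; *-identity = *-identityˡ , comm∧idˡ⇒idʳ *-comm *-identityˡ
      ; distrib = distribˡ , comm∧distrˡ⇒distrʳ *-comm distribˡ }
    ; *-comm = *-comm }

  +-*-commutativeRing : CommutativeRing _ _
  +-*-commutativeRing = record { isCommutativeRing = +-*-isCommutativeRing }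

  open CommutativeRing +-*-commutativeRing
    using (-‿inverseʳ; *-identityʳ; distribʳ; zeroˡ; ring; +-commutativeSemigroup)
  open RingProperties ring
    using (-1*x≈-x; -‿involutive; //-rightDividesˡ; //-rightDividesʳ; [y-z]x≈yx-zx)
  open CommutativeSemigroupProperties +-commutativeSemigroup
    using (interchange; x∙yz≈y∙xz)

  x+[y-x]≡y : ∀ x y → x + (y - x) ≡ y
  x+[y-x]≡y x y = trans (+-comm x (y - x)) (//-rightDividesˡ x y)

  ≤-isPartialOrder : IsPartialOrder _≡_ _≤_
  ≤-isPartialOrder = record
    { isPreorder = record
      { isEquivalence = isEquivalence
      ; reflexive = λ { refl → ≤-refl _ }
      ; trans = ≤-trans }
    ; antisym = ≤-antisym }

  ≤-poset : Poset _ _ _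
  ≤-poset = record { isPartialOrder = ≤-isPartialOrder }

  module ≤-Reasoning = PosetReasoning ≤-poset

  +-monoʳ-≤ : ∀ {x y} z → x ≤ y → z + x ≤ z + y
  +-monoʳ-≤ {x} {y} z x≤y rewrite +-comm z x | +-comm z y = +-monoˡ-≤ z x≤y

  +-mono-≤ : ∀ {x y u v} → x ≤ y → u ≤ v → x + u ≤ y + v
  +-mono-≤ {y = y} {u} x≤y u≤v = ≤-trans (+-monoˡ-≤ u x≤y) (+-monoʳ-≤ y u≤v)

  x+y≤z⇒x≤z-y : ∀ {x y z} → x + y ≤ z → x ≤ z - y
  x+y≤z⇒x≤z-y {x} {y} {z} p = begin
    x          ≡⟨ sym (//-rightDividesʳ y x) ⟩
    x + y - y  ≤⟨ +-monoˡ-≤ (- y) p ⟩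
    z - y      ∎
    where open ≤-Reasoning

  z≤x+y⇒z-y≤x : ∀ {x y z} → z ≤ x + y → z - y ≤ x
  z≤x+y⇒z-y≤x {x} {y} {z} p = begin
    z - y      ≤⟨ +-monoˡ-≤ (- y) p ⟩
    x + y - y  ≡⟨ //-rightDividesʳ y x ⟩
    x          ∎
    where open ≤-Reasoning

  +-cancelʳ-≤ : ∀ {x y} z → x + z ≤ y + z → x ≤ y
  +-cancelʳ-≤ {x} {y} z p = begin
    x          ≡⟨ sym (//-rightDividesʳ z x) ⟩
    x + z - z  ≤⟨ +-monoˡ-≤ (- z) p ⟩
    y + z - z  ≡⟨ //-rightDividesʳ z y ⟩
    y          ∎
    where open ≤-Reasoning

  +-cancelˡ-≤ : ∀ {x y} z → z + x ≤ z + y → x ≤ y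
  +-cancelˡ-≤ {x} {y} z p rewrite +-comm z x | +-comm z y = +-cancelʳ-≤ z p

  x≤y⇒0≤y-x : ∀ {x y} → x ≤ y → 0# ≤ y - x
  x≤y⇒0≤y-x {x} {y} p = begin
    0#     ≡⟨ sym (-‿inverseʳ x) ⟩
    x - x  ≤⟨ +-monoˡ-≤ (- x) p ⟩
    y - x  ∎
    where open ≤-Reasoning

  0≤y-x⇒x≤y : ∀ {x y} → 0# ≤ y - x → x ≤ y
  0≤y-x⇒x≤y {x} {y} p = begin
    x           ≡⟨ sym (+-identityˡ x) ⟩
    0# + x      ≤⟨ +-monoˡ-≤ x p ⟩
    y - x + x   ≡⟨ //-rightDividesˡ x y ⟩
    y           ∎
    where open ≤-Reasoning

  *-monoʳ-≤ : ∀ {x y} z → 0# ≤ z → x ≤ y → x * z ≤ y * z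
  *-monoʳ-≤ {x} {y} z 0≤z x≤y = 0≤y-x⇒x≤y (begin
    0#             ≤⟨ *-nonneg (x≤y⇒0≤y-x x≤y) 0≤z ⟩
    (y - x) * z    ≡⟨ [y-z]x≈yx-zx z y x ⟩
    y * z - x * z  ∎)
    where open ≤-Reasoning

  0≤1 : 0# ≤ 1#
  0≤1 with ≤-total 0# 1#
  ... | inj₁ 0≤1 = 0≤1
  ... | inj₂ 1≤0 = begin
    0#               ≤⟨ *-nonneg 0≤-1 0≤-1 ⟩
    - 1# * - 1#      ≡⟨ -1*x≈-x (- 1#) ⟩
    - - 1#           ≡⟨ -‿involutive 1# ⟩
    1#               ∎
    where
      open ≤-Reasoning
      0≤-1 : 0# ≤ - 1#
      0≤-1 = begin
        0#         ≡⟨ sym (-‿inverseʳ 1#) ⟩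
        1# - 1#    ≤⟨ +-monoˡ-≤ (- 1#) 1≤0 ⟩
        0# - 1#    ≡⟨ +-identityˡ (- 1#) ⟩
        - 1#       ∎

  0≤x⇒1≤x+1 : ∀ {x} → 0# ≤ x → 1# ≤ x + 1#
  0≤x⇒1≤x+1 {x} 0≤x = begin
    1#        ≡⟨ sym (+-identityˡ 1#) ⟩
    0# + 1#   ≤⟨ +-monoˡ-≤ 1# 0≤x ⟩
    x + 1#    ∎
    where open ≤-Reasoning

  frac*[x+1]≡x : ∀ {x} → 0# ≤ x → frac R x * (x + 1#) ≡ x
  frac*[x+1]≡x {x} 0≤x = begin
    x * (x + 1#) ⁻¹ * (x + 1#)  ≡⟨ *-assoc x _ _ ⟩
    x * ((x + 1#) ⁻¹ * (x + 1#)) ≡⟨ cong (x *_) (trans (*-comm _ (x + 1#)) (*-inverseʳ _ x+1≢0)) ⟩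
    x * 1#                      ≡⟨ *-identityʳ x ⟩
    x                           ∎
    where
      open ≡-Reasoning
      x+1≢0 : x + 1# ≢ 0#
      x+1≢0 x+1≡0 = 0≢1 (≤-antisym 0≤1 (subst (1# ≤_) x+1≡0 (0≤x⇒1≤x+1 0≤x)))

  sumF-cong : ∀ {n} {f g : Fin n → Carrier} → (∀ j → f j ≡ g j) → sumF R f ≡ sumF R g
  sumF-cong {zero} f≡g = refl
  sumF-cong {suc n} f≡g = cong₂ _+_ (f≡g fzero) (sumF-cong (λ j → f≡g (fsuc j)))

  sumF-mono : ∀ {n} {f g : Fin n → Carrier} → (∀ j → f j ≤ g j) → sumF R f ≤ sumF R g
  sumF-mono {zero} f≤g = ≤-refl 0#
  sumF-mono {suc n} f≤g = +-mono-≤ (f≤g fzero) (sumF-mono (λ j → f≤g (fsuc j)))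

  sumF-+ : ∀ {n} (f g : Fin n → Carrier) → sumF R (λ j → f j + g j) ≡ sumF R f + sumF R g
  sumF-+ {zero} f g = sym (+-identityˡ 0#)
  sumF-+ {suc n} f g = trans (cong (f fzero + g fzero +_) (sumF-+ (tail f) (tail g)))
                             (interchange (f fzero) (g fzero) _ _)

  sumF-*ʳ : ∀ {n} (f : Fin n → Carrier) c → sumF R (λ j → f j * c) ≡ sumF R f * c
  sumF-*ʳ {zero} f c = sym (zeroˡ c)
  sumF-*ʳ {suc n} f c = trans (cong (f fzero * c +_) (sumF-*ʳ (tail f) c))
                              (sym (distribʳ c (f fzero) _))

  sumExcept : ∀ {n} → Fin (suc n) → (Fin (suc n) → Carrier) → Carrier
  sumExcept k f = sumF R (λ j → f (punchIn k j))

  sumF≡at+sumExcept : ∀ {n} (k : Fin (suc n)) f → sumF R f ≡ f k + sumExcept k f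
  sumF≡at+sumExcept fzero f = refl
  sumF≡at+sumExcept {suc n} (fsuc k) f =
    trans (cong (f fzero +_) (sumF≡at+sumExcept k (λ j → f (fsuc j))))
          (x∙yz≈y∙xz (f fzero) (f (fsuc k)) _)

  sumF-replaceAt : ∀ {n} (k : Fin (suc n)) v f → sumF R (replaceAt k v f) ≡ v + sumExcept k f
  sumF-replaceAt k v f = begin
    sumF R (replaceAt k v f)
      ≡⟨ sumF≡at+sumExcept k (replaceAt k v f) ⟩
    replaceAt k v f k + sumExcept k (replaceAt k v f)
      ≡⟨ cong₂ _+_ (replaceAt-here k v f) (sumF-cong (λ j → replaceAt-there v f (punchInᵢ≢i k j))) ⟩
    v + sumExcept k f
      ∎
    where open ≡-Reasoning

  ⟦_,_⟧ : Carrier → Carrier → Pred Carrier _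
  ⟦ a , b ⟧ y = a ≤ y × y ≤ b

  ⟦⟧-cong : ∀ {a a′ b b′} → a ≡ a′ → b ≡ b′ → ⟦ a , b ⟧ ≐ ⟦ a′ , b′ ⟧
  ⟦⟧-cong refl refl = (λ y∈ → y∈) , (λ y∈ → y∈)

  ⟦⟧-mono : ∀ {a a′ b b′} → a′ ≤ a → b ≤ b′ → ⟦ a , b ⟧ ⊆ ⟦ a′ , b′ ⟧
  ⟦⟧-mono a′≤a b≤b′ (a≤y , y≤b) = ≤-trans a′≤a a≤y , ≤-trans y≤b b≤b′

  minkSum-mono : ∀ {n} {S T : Fin n → Pred Carrier _} →
    (∀ j → S j ⊆ T j) → MinkSum R S ⊆ MinkSum R T
  minkSum-mono S⊆T (p , p∈S , y≡Σp) = p , (λ j → S⊆T j (p∈S j)) , y≡Σp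

  minkSum-intervals-⊆ : ∀ {n} (lo hi : Fin n → Carrier) →
    MinkSum R (λ j → ⟦ lo j , hi j ⟧) ⊆ ⟦ sumF R lo , sumF R hi ⟧
  minkSum-intervals-⊆ lo hi (p , p∈ , refl) =
    sumF-mono (λ j → proj₁ (p∈ j)) , sumF-mono (λ j → proj₂ (p∈ j))

  minkSum-cons : ∀ {n} {S : Fin (suc n) → Pred Carrier _} {z y} →
    S fzero z → MinkSum R (tail S) y → MinkSum R S (z + y)
  minkSum-cons z∈ (q , q∈ , refl) = (_ ∷ q) , (λ { fzero → z∈ ; (fsuc j) → q∈ j }) , refl

  minkSum-intervals-⊇ : ∀ {n} (lo hi : Fin n → Carrier) → (∀ j → lo j ≤ hi j) →
    ⟦ sumF R lo , sumF R hi ⟧ ⊆ MinkSum R (λ j → ⟦ lo j , hi j ⟧)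
  minkSum-intervals-⊇ {zero} lo hi _ (0≤y , y≤0) = (λ ()) , (λ ()) , ≤-antisym y≤0 0≤y
  minkSum-intervals-⊇ {suc n} lo hi lo≤hi {y} (Σlo≤y , y≤Σhi) =
    [ firstAtLower , restAtUpper ]′ (≤-total y (lo fzero + sumF R (tail hi)))
    where
      I : Fin (suc n) → Pred Carrier _
      I j = ⟦ lo j , hi j ⟧

      firstAtLower : y ≤ lo fzero + sumF R (tail hi) → MinkSum R I y
      firstAtLower y≤lo₀+Σhi′ =
        subst (MinkSum R I) (x+[y-x]≡y (lo fzero) y)
          (minkSum-cons {S = I} (≤-refl _ , lo≤hi fzero)
            (minkSum-intervals-⊇ (tail lo) (tail hi) (λ j → lo≤hi (fsuc j))
              ( x+y≤z⇒x≤z-y (subst (_≤ y) (+-comm (lo fzero) _) Σlo≤y)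
              , z≤x+y⇒z-y≤x (subst (y ≤_) (+-comm (lo fzero) _) y≤lo₀+Σhi′))))

      restAtUpper : lo fzero + sumF R (tail hi) ≤ y → MinkSum R I y
      restAtUpper lo₀+Σhi′≤y =
        subst (MinkSum R I) (//-rightDividesˡ (sumF R (tail hi)) y)
          (minkSum-cons {S = I} (x+y≤z⇒x≤z-y lo₀+Σhi′≤y , z≤x+y⇒z-y≤x y≤Σhi)
            (tail hi , (λ j → lo≤hi (fsuc j) , ≤-refl _) , refl))

  minkSum-intervals-split : ∀ {n} (lo hi : Fin (suc n) → Carrier) → (∀ j → lo j ≤ hi j) →
    ∀ k {l r} {S T : Pred Carrier _} → S ≐ ⟦ lo k , l ⟧ → T ≐ ⟦ r , hi k ⟧ →
    lo k ≤ l → l ≤ r → r ≤ hi k → r - l ≤ sumExcept k (λ j → hi j - lo j) →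
    SetEq R (MinkSum R (λ j → ⟦ lo j , hi j ⟧))
      (Union R (MinkSum R (replaceAt k S (λ j → ⟦ lo j , hi j ⟧)))
               (MinkSum R (replaceAt k T (λ j → ⟦ lo j , hi j ⟧))))
  minkSum-intervals-split {n} lo hi lo≤hi k {l} {r} {S} {T} S≐ T≐ lo≤l l≤r r≤hi gap≤others y =
    split , merge
    where
      I : Fin (suc n) → Pred Carrier _
      I j = ⟦ lo j , hi j ⟧

      lo′ hi′ : Fin n → Carrier
      lo′ j = lo (punchIn k j)
      hi′ j = hi (punchIn k j)

      sums-overlap : sumF R (replaceAt k r lo) ≤ sumF R (replaceAt k l hi)
      sums-overlap = begin
        sumF R (replaceAt k r lo)                ≡⟨ sumF-replaceAt k r lo ⟩
        r + sumExcept k lo                       ≡⟨ cong (_+ sumExcept k lo) (sym (x+[y-x]≡y l r)) ⟩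
        l + (r - l) + sumExcept k lo             ≡⟨ +-assoc l _ _ ⟩
        l + (r - l + sumExcept k lo)             ≤⟨ +-monoʳ-≤ l (+-monoˡ-≤ _ gap≤others) ⟩
        l + (sumExcept k (λ j → hi j - lo j) + sumExcept k lo)
          ≡⟨ cong (l +_) (sym (sumF-+ (λ j → hi′ j - lo′ j) lo′)) ⟩
        l + sumF R (λ j → hi′ j - lo′ j + lo′ j)
          ≡⟨ cong (l +_) (sumF-cong (λ j → //-rightDividesˡ (lo′ j) (hi′ j))) ⟩
        l + sumExcept k hi                       ≡⟨ sym (sumF-replaceAt k l hi) ⟩
        sumF R (replaceAt k l hi)                ∎
        where open ≤-Reasoning

      split : MinkSum R I y → Union R (MinkSum R (replaceAt k S I)) (MinkSum R (replaceAt k T I)) y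
      split y∈ with minkSum-intervals-⊆ lo hi y∈ | ≤-total y (sumF R (replaceAt k l hi))
      ... | Σlo≤y , _ | inj₁ y≤Σhiˡ =
        inj₁ (minkSum-mono
               (replaceAt-pointwise (λ j u X → ⟦ lo j , u ⟧ ⊆ X) (proj₂ S≐) (λ j y∈ → y∈))
               (minkSum-intervals-⊇ lo (replaceAt k l hi)
                  (replaceAt-all (λ j u → lo j ≤ u) lo≤l lo≤hi) (Σlo≤y , y≤Σhiˡ)))
      ... | _ , y≤Σhi | inj₂ Σhiˡ≤y =
        inj₂ (minkSum-mono
               (replaceAt-pointwise (λ j u X → ⟦ u , hi j ⟧ ⊆ X) (proj₂ T≐) (λ j y∈ → y∈))
               (minkSum-intervals-⊇ (replaceAt k r lo) hi
                  (replaceAt-all (λ j u → u ≤ hi j) r≤hi lo≤hi)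
                  (≤-trans sums-overlap Σhiˡ≤y , y≤Σhi)))

      merge : Union R (MinkSum R (replaceAt k S I)) (MinkSum R (replaceAt k T I)) y → MinkSum R I y
      merge = [ minkSum-mono (replaceAt-all (λ j X → X ⊆ I j) S⊆Iₖ (λ j y∈ → y∈))
              , minkSum-mono (replaceAt-all (λ j X → X ⊆ I j) T⊆Iₖ (λ j y∈ → y∈)) ]
        where
          S⊆Iₖ : S ⊆ I k
          S⊆Iₖ y∈ = ⟦⟧-mono (≤-refl _) (≤-trans l≤r r≤hi) (proj₁ S≐ y∈)
          T⊆Iₖ : T ⊆ I k
          T⊆Iₖ y∈ = ⟦⟧-mono (≤-trans lo≤l l≤r) (≤-refl _) (proj₁ T≐ y∈)

  comparable⇒≤sumExcept : ∀ {n} (k : Fin (suc n)) (x len : Fin (suc n) → Carrier) {g} →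
    0# ≤ x k → 0# ≤ g → 1# ≤ sumF R (λ j → frac R (x j)) →
    (∀ j → frac R (x j) * (x k + 1#) * g ≤ len j) → g ≤ sumExcept k len
  comparable⇒≤sumExcept k x len {g} 0≤xₖ 0≤g 1≤Σfrac c≤len = +-cancelˡ-≤ (x k * g) (begin
    x k * g + g
      ≡⟨ cong (x k * g +_) (sym (*-identityˡ g)) ⟩
    x k * g + 1# * g
      ≡⟨ sym (distribʳ g (x k) 1#) ⟩
    M
      ≡⟨ sym (*-identityˡ M) ⟩
    1# * M
      ≤⟨ *-monoʳ-≤ M 0≤M 1≤Σfrac ⟩
    sumF R (λ j → frac R (x j)) * M
      ≡⟨ sym (sumF-*ʳ (λ j → frac R (x j)) M) ⟩
    sumF R (λ j → frac R (x j) * M)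
      ≡⟨ sumF-cong (λ j → sym (*-assoc (frac R (x j)) (x k + 1#) g)) ⟩
    sumF R c
      ≡⟨ sumF≡at+sumExcept k c ⟩
    c k + sumExcept k c
      ≡⟨ cong (λ t → t * g + sumExcept k c) (frac*[x+1]≡x 0≤xₖ) ⟩
    x k * g + sumExcept k c
      ≤⟨ +-monoʳ-≤ (x k * g) (sumF-mono (λ j → c≤len (punchIn k j))) ⟩
    x k * g + sumExcept k len
      ∎)
    where
      open ≤-Reasoning
      M = (x k + 1#) * g
      c = λ j → frac R (x j) * (x k + 1#) * g
      0≤M : 0# ≤ M
      0≤M = *-nonneg (≤-trans 0≤1 (0≤x⇒1≤x+1 0≤xₖ)) 0≤g

  module CantorInterval (C : Cantor R) {i} (i≥1 : 1 ≤ℕ i) where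
    open Cantor C

    lft≤gl : lft i ≤ gl i
    lft≤gl = proj₁ (proj₁ (gap-inside i i≥1))

    gl≤gr : gl i ≤ gr i
    gl≤gr = proj₁ (proj₁ (proj₂ (gap-inside i i≥1)))

    gr≤rgt : gr i ≤ rgt i
    gr≤rgt = proj₁ (proj₂ (proj₂ (gap-inside i i≥1)))

    lft≤rgt : lft i ≤ rgt i
    lft≤rgt = ≤-trans lft≤gl (≤-trans gl≤gr gr≤rgt)

    Iv-left-child : Iv R C (2 *ℕ i) ≐ ⟦ lft i , gl i ⟧
    Iv-left-child = ⟦⟧-cong (proj₁ (left-child i i≥1)) (proj₂ (left-child i i≥1))

    Iv-right-child : Iv R C (suc (2 *ℕ i)) ≐ ⟦ gr i , rgt i ⟧
    Iv-right-child = ⟦⟧-cong (proj₁ (right-child i i≥1)) (proj₂ (right-child i i≥1))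

lemma3p4 : (R : Reals) (n : ℕ) → 2 ≤ℕ n →
    (C : Fin n → Cantor R) → (x : Fin n → Reals.Carrier R) →
    (∀ j → HoleDecreasing R (C j)) →
    (∀ j → Reals._≤_ R (Reals.0# R) (x j)) →
    (∀ j → DrAtLeast R (C j) (x j)) →
    Reals._≤_ R (Reals.1# R) (sumF R (λ j → frac R (x j))) →
    (∀ j k → Reals._≤_ R
       (Reals._*_ R (Reals._*_ R (frac R (x j)) (Reals._+_ R (x k) (Reals.1# R))) (len R (C k) 1))
       (len R (C j) 1)) →
    (i : Fin n → ℕ) → (∀ j → 1 ≤ℕ i j) → Comparable R C x i →
    (k : Fin n) →
    SetEq R (MinkSum R (λ j → Iv R (C j) (i j)))
      (Union R
        (MinkSum R (replaceAt k (Iv R (C k) (2 *ℕ i k)) (λ j → Iv R (C j) (i j))))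
        (MinkSum R (replaceAt k (Iv R (C k) (suc (2 *ℕ i k))) (λ j → Iv R (C j) (i j)))))
lemma3p4 R (suc n) _ C x _ 0≤x _ 1≤Σfrac _ i i≥1 comparable k =
  minkSum-intervals-split R lo hi (λ j → CantorInterval.lft≤rgt R (C j) (i≥1 j)) k
    Iv-left-child Iv-right-child lft≤gl gl≤gr gr≤rgt
    (comparable⇒≤sumExcept R k x (λ j → len R (C j) (i j)) (0≤x k)
       (x≤y⇒0≤y-x R gl≤gr) 1≤Σfrac (λ j → comparable j k))
  where
    open CantorInterval R (C k) (i≥1 k)

    lo hi : Fin (suc n) → Reals.Carrier R
    lo j = Cantor.lft (C j) (i j)
    hi j = Cantor.rgt (C j) (i j)
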